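{- Let $A,B$ be sets. Then $\mathsf{reflect}\circ\mathsf{reify}=\mathrm{id}_{E_{AB}}$, where $\mathsf{reify}\colon E_{AB}\to I_{AB}$ is the unique $T_A(B\times-)$-coalgebra map from $\check{E}_{AB}$ to the final coalgebra $I_{AB}$, and $\mathsf{reflect}\colon I_{AB}\to E_{AB}$ is the trace function of $I_{AB}$.
   Context: $T_A(V)$ is the set of well-founded $A$-ary trees with leaves in $V$ (leaves $v$, nodes $\mathsf{read}(\lambda a.\,t_a)$); an $A$-ary magma is a set $X$ with $\xi\colon X^A\to X$. $\theta\colon I_{AB}\to T_A(B\times I_{AB})$ is a final coalgebra for the functor $T_A(B\times-)$; coalgebra maps $f\colon(X,\alpha)\to(Y,\beta)$ satisfy $\beta f=T_A(B\times f)\alpha$. Streams carry the product of discrete topologies; $\partial$ is the shift. $E_{AB}=\mathbf{Top}(A^{\mathbb{N}},B^{\mathbb{N}})$ is the set of continuous maps, an $A$-ary magma via $\mathsf{split}(\vec f)(\vec a)=f_{a_0}(\partial\vec a)$. The $B$-fold copower $B\cdot E_{AB}$ in $A$-ary magmas is represented as the set of trees in $T_A(B\times E_{AB})$ in which no subtree rooted at an interior node has all its leaves labelled by the same element of $B$, with coprojections $f\mapsto$ leaf $(b,f)$ and operation $\upsilon(\lambda a.\,t_a)=(b,\mathsf{split}(\lambda a.\,f_a))$ if each $t_a$ is a leaf $(b,f_a)$ with common $b$, else $\mathsf{read}(\lambda a.\,t_a)$. Let $\delta\colon E_{AB}\to B\cdot E_{AB}$ be the composite of postcomposition with the homeomorphism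 $B^{\mathbb{N}}\to B\times B^{\mathbb{N}}$, $\vec b\mapsto(b_0,\partial\vec b)$, and the inverse of the magma isomorphism $B\cdot E_{AB}\to\mathbf{Top}(A^{\mathbb{N}},B\times B^{\mathbb{N}})$ whose $b$-th component is $f\mapsto(\vec a\mapsto(b,f(\vec a)))$. $\check{E}_{AB}$ is the $T_A(B\times-)$-coalgebra on $E_{AB}$ with structure $\delta$ followed by the inclusion $B\cdot E_{AB}\subseteq T_A(B\times E_{AB})$. For $t\in T_A(V)$, $\langle t\rangle\colon A^{\mathbb{N}}\to V\times A^{\mathbb{N}}$ is given by $\langle v\rangle(\vec a)=(v,\vec a)$, $\langle\mathsf{read}(\lambda a.\,t_a)\rangle(\vec a)=\langle t_{a_0}\rangle(\partial\vec a)$. Writing $\langle\theta(\sigma)\rangle(\vec a)=(\mathsf{hd}(\sigma,\vec a),\mathsf{next}(\sigma,\vec a),\mathsf{tl}(\sigma,\vec a))$, $\mathsf{reflect}(\sigma)\colon A^{\mathbb{N}}\to B^{\mathbb{N}}$ is defined coinductively by $(\mathsf{reflect}(\sigma)(\vec a))_0=\mathsf{hd}(\sigma,\vec a)$ and $\partial(\mathsf{reflect}(\sigma)(\vec a))=\mathsf{reflect}(\mathsf{next}(\sigma,\vec a))(\mathsf{tl}(\sigma,\vec a))$; it is continuous. -}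

module Defs where

open import Data.Nat using (ℕ; zero; suc; _<_)
open import Data.Product using (Σ; ∃; _×_; _,_; proj₁; proj₂; map₂)
open import Data.Empty using (⊥)
open import Data.Unit using (⊤)
open import Relation.Nullary using (¬_)
open import Relation.Binary.PropositionalEquality using (_≡_)

Stream : Set → Set
Stream A = ℕ → A

∂ : {A : Set} → Stream A → Stream A
∂ s n = s (suc n)

-- Continuity for the product of discrete topologies:
-- every finite prefix of the output depends only on a finite prefix of the input.
Continuous : {A B : Set} → (Stream A → Stream B) → Set
Continuous {A} {B} f =
  (a : Stream A) (n : ℕ) → ∃ λ m → (a' : Stream A) →
    ((i : ℕ) → i < m → a' i ≡ a i) → (j : ℕ) → j < n → f a' j ≡ f a j

E : Set → Set → Set
E A B = Σ (Stream A → Stream B) Continuous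

data Tree (A V : Set) : Set where
  leaf : V → Tree A V
  read : (A → Tree A V) → Tree A V

mapTree : {A V W : Set} → (V → W) → Tree A V → Tree A W
mapTree g (leaf v) = leaf (g v)
mapTree g (read t) = read (λ a → mapTree g (t a))

data TreeEq {A V : Set} : Tree A V → Tree A V → Set where
  leaf : {v w : V} → v ≡ w → TreeEq (leaf v) (leaf w)
  read : {t u : A → Tree A V} → ((a : A) → TreeEq (t a) (u a)) → TreeEq (read t) (read u)

⟨_⟩ : {A V : Set} → Tree A V → Stream A → V × Stream A
⟨ leaf v ⟩ a = v , a
⟨ read t ⟩ a = ⟨ t (a 0) ⟩ (∂ a)

-- Coalgebras for T_A(B × -) and coalgebra maps: β ∘ h = T_A(B × h) ∘ α.
IsCoalgMap : {A B X Y : Set} → (X → Tree A (B × X)) → (Y → Tree A (B × Y)) → (X → Y) → Set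
IsCoalgMap α β h = ∀ x → TreeEq (β (h x)) (mapTree (map₂ h) (α x))

IsFinal : {A B Y : Set} → (Y → Tree A (B × Y)) → Set₁
IsFinal {A} {B} {Y} θ = (X : Set) (α : X → Tree A (B × X)) →
  Σ (X → Y) λ h → IsCoalgMap α θ h × ((h' : X → Y) → IsCoalgMap α θ h' → (x : X) → h' x ≡ h x)

-- The B-fold copower B · E_AB: trees in which no subtree rooted at an interior node
-- has all its leaves labelled by the same element of B.
data AllLabelled {A B V : Set} (b : B) : Tree A (B × V) → Set where
  leaf : {v : V} → AllLabelled b (leaf (b , v))
  read : {t : A → Tree A (B × V)} → ((a : A) → AllLabelled b (t a)) → AllLabelled b (read t)

InCopower : {A B V : Set} → Tree A (B × V) → Set
InCopower (leaf _) = ⊤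
InCopower {A} {B} (read t) = (¬ Σ B λ b → AllLabelled b (read t)) × ((a : A) → InCopower (t a))

-- The magma isomorphism B · E_AB → Top(A^ℕ, B × B^ℕ): the unique magma map whose b-th
-- component is f ↦ (a ↦ (b , f a)); on trees it is leaf (b,f) ↦ (a ↦ (b , f a)),
-- read t ↦ split (λ a → iso (t a)), i.e. the following.
copowerIso : {A B : Set} → Tree A (B × E A B) → Stream A → B × Stream B
copowerIso t a with ⟨ t ⟩ a
... | (b , f) , a' = b , proj₁ f a'

headTail : {B : Set} → Stream B → B × Stream B
headTail s = s 0 , ∂ s

_≈BS_ : {B : Set} → B × Stream B → B × Stream B → Set
(b , s) ≈BS (c , r) = (b ≡ c) × ((n : ℕ) → s n ≡ r n)

-- δ : E_AB → B · E_AB is the inverse of copowerIso after postcomposition with headTail;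
-- characterised by: lands in B · E_AB and copowerIso ∘ δ = headTail ∘ (-) (extensionally).
IsDelta : {A B : Set} → (E A B → Tree A (B × E A B)) → Set
IsDelta {A} {B} δ = ((f : E A B) → InCopower (δ f))
  × ((f : E A B) (a : Stream A) → copowerIso (δ f) a ≈BS headTail (proj₁ f a))

-- The trace function of a coalgebra (coinductive definition unfolded on indices).
trace : {A B X : Set} → (X → Tree A (B × X)) → X → Stream A → Stream B
trace α x a zero = proj₁ (proj₁ (⟨ α x ⟩ a))
trace α x a (suc n) = trace α (proj₂ (proj₁ (⟨ α x ⟩ a))) (proj₂ (⟨ α x ⟩ a)) n

{-# OPTIONS --safe #-}
module Submission where

-- Traces are preserved by coalgebra maps, so reflect (reify f) is the trace of f in the
-- coalgebra Ě_AB. By the defining property of δ, the first output of δ f on a is the head of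
-- f a and the leaf reached carries a continuous map producing the tail of f a; hence the trace
-- of f in Ě_AB is f itself, by induction on the output index.

open import Defs
open import Data.Nat using (ℕ; zero; suc)
open import Data.Product using (_×_; _,_; proj₁; proj₂; map₁; map₂)
open import Function using (_∘_)
open import Relation.Binary.PropositionalEquality using (_≡_; refl; trans; cong; module ≡-Reasoning)

⟨⟩-cong : {A V : Set} {t u : Tree A V} → TreeEq t u → (a : Stream A) → ⟨ t ⟩ a ≡ ⟨ u ⟩ a
⟨⟩-cong (leaf refl) a = refl
⟨⟩-cong (read t≈u) a = ⟨⟩-cong (t≈u (a 0)) (∂ a)

⟨⟩-mapTree : {A V W : Set} (g : V → W) (t : Tree A V) (a : Stream A) →
  ⟨ mapTree g t ⟩ a ≡ map₁ g (⟨ t ⟩ a)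
⟨⟩-mapTree g (leaf v) a = refl
⟨⟩-mapTree g (read t) a = ⟨⟩-mapTree g (t (a 0)) (∂ a)

⟨⟩-coalgMap : {A B X Y : Set} (α : X → Tree A (B × X)) (β : Y → Tree A (B × Y)) {h : X → Y} →
  IsCoalgMap α β h → (x : X) (a : Stream A) → ⟨ β (h x) ⟩ a ≡ map₁ (map₂ h) (⟨ α x ⟩ a)
⟨⟩-coalgMap α β {h} hom x a = trans (⟨⟩-cong (hom x) a) (⟨⟩-mapTree (map₂ h) (α x) a)

trace-coalgMap : {A B X Y : Set} {α : X → Tree A (B × X)} {β : Y → Tree A (B × Y)} {h : X → Y} →
  IsCoalgMap α β h → (x : X) (a : Stream A) (n : ℕ) → trace β (h x) a n ≡ trace α x a n
trace-coalgMap {α = α} {β} hom x a zero = cong (proj₁ ∘ proj₁) (⟨⟩-coalgMap α β hom x a)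
trace-coalgMap {α = α} {β} hom x a (suc n) =
  trans (cong (λ p → trace β (proj₂ (proj₁ p)) (proj₂ p) n) (⟨⟩-coalgMap α β hom x a))
        (trace-coalgMap hom (proj₂ (proj₁ (⟨ α x ⟩ a))) (proj₂ (⟨ α x ⟩ a)) n)

copowerIso-⟨⟩ : {A B : Set} (t : Tree A (B × E A B)) (a : Stream A) →
  copowerIso t a ≡ (proj₁ (proj₁ (⟨ t ⟩ a)) , proj₁ (proj₂ (proj₁ (⟨ t ⟩ a))) (proj₂ (⟨ t ⟩ a)))
copowerIso-⟨⟩ t a with ⟨ t ⟩ a
... | (b , f) , a' = refl

trace-delta : {A B : Set} (δ : E A B → Tree A (B × E A B)) →
  ((f : E A B) (a : Stream A) → copowerIso (δ f) a ≈BS headTail (proj₁ f a)) →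
  (f : E A B) (a : Stream A) (n : ℕ) → trace δ f a n ≡ proj₁ f a n
trace-delta δ δ-iso f a n with δ-iso f a | copowerIso-⟨⟩ (δ f) a
trace-delta δ δ-iso f a zero | head≡ , _ | refl = head≡
trace-delta {A} {B} δ δ-iso f a (suc n) | _ , tail≡ | refl = begin
  trace δ f′ a′ n   ≡⟨ trace-delta δ δ-iso f′ a′ n ⟩
  proj₁ f′ a′ n     ≡⟨ tail≡ n ⟩
  proj₁ f a (suc n) ∎
  where
  open ≡-Reasoning
  f′ : E A B
  f′ = proj₂ (proj₁ (⟨ δ f ⟩ a))
  a′ : Stream A
  a′ = proj₂ (⟨ δ f ⟩ a)

proposition6p7 : (A B : Set) (I : Set) (θ : I → Tree A (B × I)) → IsFinal θ →
    (δ : E A B → Tree A (B × E A B)) → IsDelta δ →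
    (reify : E A B → I) → IsCoalgMap δ θ reify →
    (f : E A B) (a : Stream A) (n : ℕ) → trace θ (reify f) a n ≡ proj₁ f a n
proposition6p7 A B I θ _ δ (_ , δ-iso) reify reify-hom f a n =
  trans (trace-coalgMap reify-hom f a n) (trace-delta δ δ-iso f a n)
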